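{- Let $f\in\mathbb{F}[x_1,\dots,x_n]$ be a polynomial of degree $d$, where $d<\mathrm{char}(\mathbb{F})$ if $\mathrm{char}(\mathbb{F})\neq0$. Then $\mathbf a\in\mathcal S_f$ if and only if $f^{(1)}(\mathbf a,\mathbf x)\equiv0$.
   Context: $\mathcal S_f=\{\mathbf a\in\mathbb{F}^n: f(\mathbf x+\mathbf a)\equiv f(\mathbf x)\}$. The first-order (formal) directional derivative in direction $\mathbf a$ is $f^{(1)}(\mathbf a,\mathbf x)=\sum_{t=1}^n a_t\,\frac{\partial f}{\partial x_t}(\mathbf x)$. $\equiv$ denotes identity of polynomials. -}

module Defs where

open import Level using (Level; _⊔_) renaming (suc to lsuc)
open import Algebra.Bundles using (CommutativeRing)
open import Data.Nat as ℕ using (ℕ; zero; suc; _<_; pred)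
open import Data.Fin using (Fin)
open import Data.Vec as Vec using (Vec; lookup; replicate; _[_]≔_; zipWith)
open import Data.Vec.Properties using (≡-dec)
open import Data.List as List using (List; []; _∷_; _++_; map; concatMap)
open import Data.List.Base using (allFin)
open import Data.Product using (_×_; _,_; ∃)
open import Relation.Nullary using (¬_; yes; no)
open import Relation.Binary.PropositionalEquality using (_≡_)

record Field (c ℓ : Level) : Set (lsuc (c ⊔ ℓ)) where
  field
    commutativeRing : CommutativeRing c ℓ
  open CommutativeRing commutativeRing public
  field
    0≉1     : ¬ (0# ≈ 1#)
    inverse : ∀ x → ¬ (x ≈ 0#) → ∃ λ y → x * y ≈ 1#

module _ {c ℓ : Level} (F : Field c ℓ) where
  open Field F

  natMul : ℕ → Carrier → Carrier
  natMul zero    x = 0#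
  natMul (suc k) x = x + natMul k x

  HasChar : ℕ → Set ℓ
  HasChar zero    = ∀ k → ¬ (natMul (suc k) 1# ≈ 0#)
  HasChar (suc p) = (natMul (suc p) 1# ≈ 0#) × (∀ k → suc k < suc p → ¬ (natMul (suc k) 1# ≈ 0#))

  -- Formal polynomials in x_1..x_n over F: finite lists of terms
  -- (coefficient, exponent vector).  Representation is not normalised;
  -- identity of polynomials is equality of all coefficients.
  Poly : ℕ → Set c
  Poly n = List (Carrier × Vec ℕ n)

  module _ {n : ℕ} where

    coeff : Poly n → Vec ℕ n → Carrier
    coeff []             e = 0#
    coeff ((a , m) ∷ p) e with ≡-dec ℕ._≟_ m e
    ... | yes _ = a + coeff p e
    ... | no  _ = coeff p e

    _≡ₚ_ : Poly n → Poly n → Set ℓ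
    f ≡ₚ g = ∀ e → coeff f e ≈ coeff g e

    0ₚ : Poly n
    0ₚ = []

    const : Carrier → Poly n
    const a = (a , replicate n 0) ∷ []

    var : Fin n → Poly n
    var i = (1# , (replicate n 0 [ i ]≔ 1)) ∷ []

    _+ₚ_ : Poly n → Poly n → Poly n
    _+ₚ_ = _++_

    _*ₚ_ : Poly n → Poly n → Poly n
    p *ₚ q = concatMap (λ { (a , e) → map (λ { (b , e') → (a * b , zipWith ℕ._+_ e e') }) q }) p

    scale : Carrier → Poly n → Poly n
    scale a = map (λ { (b , e) → (a * b , e) })

    powₚ : Poly n → ℕ → Poly n
    powₚ p zero    = const 1#
    powₚ p (suc k) = p *ₚ powₚ p k

    substₚ : (Fin n → Poly n) → Poly n → Poly n
    substₚ σ = concatMap (λ { (a , e) →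
      List.foldr (λ i acc → powₚ (σ i) (lookup e i) *ₚ acc) (const a) (allFin n) })

    mdeg : Vec ℕ n → ℕ
    mdeg = Vec.sum

    IsDegree : Poly n → ℕ → Set ℓ
    IsDegree f d = (∀ e → d < mdeg e → coeff f e ≈ 0#)
                 × ∃ λ e → mdeg e ≡ d × ¬ (coeff f e ≈ 0#)

    translate : (Fin n → Carrier) → Poly n → Poly n
    translate a = substₚ (λ i → var i +ₚ const (a i))

    InS : Poly n → (Fin n → Carrier) → Set ℓ
    InS f a = translate a f ≡ₚ f

    partial : Fin n → Poly n → Poly n
    partial t = map (λ { (b , e) → (natMul (lookup e t) b , (e [ t ]≔ pred (lookup e t))) })

    -- first-order directional derivative f^(1)(a, x) = Σ_t a_t ∂f/∂x_t
    dirDeriv : (Fin n → Carrier) → Poly n → Poly n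
    dirDeriv a f = concatMap (λ t → scale (a t) (partial t f)) (allFin n)

module Submission where

-- Write m + eₜ for m with its t-th exponent raised by one and |m| for the
-- total degree.  Expanding (xᵢ + aᵢ)^eᵢ binomially, the coefficient of x^m
-- in f(x + a) is  Σₖ Tₖ(m),  where Tₖ(m) = Σ_{|e| = k + |m|} f_e Πᵢ C(eᵢ,mᵢ) aᵢ^(eᵢ-mᵢ)
-- collects the contributions of the exponents e lying k degrees above m.
-- These Taylor components satisfy  T₀ = f  and the recursion
--     Σₜ aₜ (mₜ+1) Tₖ(m + eₜ) = (k+1) Tₖ₊₁(m),
-- whose case k = 0 says that T₁ is the coefficient function of f⁽¹⁾.
-- Moreover Tₖ(m) = 0 when k + |m| > d, and k+1 is invertible for k < d.
-- Hence (higher-components-vanish) if f⁽¹⁾ vanishes in all degrees ≥ s, then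
-- Tₖ₊₁(m) = 0 whenever k + |m| ≥ s.  With s = 0 this shows f(x + a) = T₀ = f;
-- conversely, if f(x + a) = f, a downward induction on |m| shows that f⁽¹⁾
-- vanishes in every degree, since in degree |m| only T₁(m) is left over.

open import Defs
open import Level using (Level)
open import Data.Nat as Nat using (ℕ; zero; suc; pred; _≤_; _<_; z≤n; s≤s; _≟_; _<?_; _≤?_)
import Data.Nat.Properties as ℕₚ
open import Data.Nat.ListAction using () renaming (sum to sumᴸ)
open import Data.Fin using (Fin; zero; suc) renaming (_≟_ to _≟ᶠ_)
open import Data.Vec using (Vec; []; _∷_; lookup; replicate; _[_]≔_; zipWith; sum)
import Data.Vec.Properties as Vecₚ
open import Data.Vec.Properties using (≡-dec)
open import Data.List as List using (List; []; _∷_; _++_; map; concatMap; foldr; allFin)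
import Data.List.Properties as Listₚ
open import Data.List.Relation.Unary.All as All using (All; []; _∷_)
import Data.List.Relation.Unary.All.Properties as Allₚ
open import Data.List.Relation.Unary.Unique.Propositional using (Unique)
open import Data.List.Relation.Unary.AllPairs using ([]; _∷_)
import Data.List.Relation.Unary.Unique.Propositional.Properties as Uniqueₚ
import Data.List.Relation.Unary.Unique.DecPropositional.Properties as DecUniqueₚ
open import Data.List.Membership.Propositional using (_∈_)
import Data.List.Membership.Propositional.Properties as ∈ₚ
open import Data.List.Relation.Unary.Any using (here; there)
open import Data.Product using (_,_; ∃; proj₁; proj₂)
open import Data.Sum using (_⊎_; inj₁; inj₂)
open import Data.Empty using (⊥-elim)
open import Function.Bundles using (_⇔_; mk⇔; Equivalence)
open import Relation.Nullary using (¬_; Dec; yes; no)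
open import Relation.Binary.PropositionalEquality
  using (_≡_; _≢_; refl; sym; trans; cong; cong₂; subst; module ≡-Reasoning)

module Exponents where

  open Nat using (_+_; _∸_)
  open ≡-Reasoning

  private variable n : ℕ

  Exp : ℕ → Set
  Exp n = Vec ℕ n

  _≼_ : Exp n → Exp n → Set
  m ≼ e = ∀ j → lookup m j ≤ lookup e j

  lookup-ext : (u v : Exp n) → (∀ j → lookup u j ≡ lookup v j) → u ≡ v
  lookup-ext u v h = trans (sym (Vecₚ.tabulate∘lookup u)) (trans (Vecₚ.tabulate-cong h) (Vecₚ.tabulate∘lookup v))

  below-or-≼ : (e m : Exp n) → (∃ λ j → lookup e j < lookup m j) ⊎ m ≼ e
  below-or-≼ [] [] = inj₂ (λ ())
  below-or-≼ (x ∷ e) (y ∷ m) with x <? y | below-or-≼ e m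
  ... | yes x<y | _              = inj₁ (zero , x<y)
  ... | no _    | inj₁ (j , e<m) = inj₁ (suc j , e<m)
  ... | no x≮y  | inj₂ m≼e       = inj₂ λ { zero → ℕₚ.≮⇒≥ x≮y ; (suc j) → m≼e j }

  sum-mono : (e m : Exp n) → m ≼ e → sum m ≤ sum e
  sum-mono []      []      _   = z≤n
  sum-mono (x ∷ e) (y ∷ m) m≼e = ℕₚ.+-mono-≤ (m≼e zero) (sum-mono e m (λ j → m≼e (suc j)))

  sum-gaps : (e m : Exp n) → m ≼ e → sumᴸ (List.tabulate (λ t → lookup e t ∸ lookup m t)) ≡ sum e ∸ sum m
  sum-gaps []      []      _   = refl
  sum-gaps (x ∷ e) (y ∷ m) m≼e = begin
    (x ∸ y) + sumᴸ (List.tabulate (λ t → lookup e t ∸ lookup m t)) ≡⟨ cong ((x ∸ y) +_) (sum-gaps e m (λ j → m≼e (suc j))) ⟩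
    (x ∸ y) + (sum e ∸ sum m)  ≡⟨ sym (ℕₚ.+-∸-assoc (x ∸ y) (sum-mono e m (λ j → m≼e (suc j)))) ⟩
    ((x ∸ y) + sum e) ∸ sum m  ≡⟨ cong (_∸ sum m) (sym (ℕₚ.+-∸-comm (sum e) (m≼e zero))) ⟩
    ((x + sum e) ∸ y) ∸ sum m  ≡⟨ ℕₚ.∸-+-assoc (x + sum e) y (sum m) ⟩
    (x + sum e) ∸ (y + sum m)  ∎

  ≼-sum-≡ : (e m : Exp n) → m ≼ e → sum e ≡ sum m → e ≡ m
  ≼-sum-≡ []      []      _   _  = refl
  ≼-sum-≡ (x ∷ e) (y ∷ m) m≼e eq with y <? x
  ... | yes y<x = ⊥-elim (ℕₚ.<⇒≢ (ℕₚ.+-mono-<-≤ y<x (sum-mono e m (λ j → m≼e (suc j)))) (sym eq))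
  ... | no y≮x  = cong₂ _∷_ x≡y (≼-sum-≡ e m (λ j → m≼e (suc j)) (ℕₚ.+-cancelˡ-≡ x _ _ (trans eq (cong (_+ sum m) (sym x≡y)))))
    where
      x≡y : x ≡ y
      x≡y = ℕₚ.≤-antisym (ℕₚ.≮⇒≥ y≮x) (m≼e zero)

  raise : Exp n → Fin n → Exp n
  raise m t = m [ t ]≔ suc (lookup m t)

  sum-raise : (m : Exp n) (t : Fin n) → sum (raise m t) ≡ suc (sum m)
  sum-raise (x ∷ m) zero    = refl
  sum-raise (x ∷ m) (suc t) = trans (cong (x +_) (sum-raise m t)) (ℕₚ.+-suc x (sum m))

  lower : Exp n → Fin n → Exp n
  lower e t = e [ t ]≔ pred (lookup e t)

  lower-raise : (m : Exp n) (t : Fin n) → lower (raise m t) t ≡ m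
  lower-raise m t = trans (cong (λ z → raise m t [ t ]≔ pred z) (Vecₚ.lookup∘update t m _))
                          (trans (Vecₚ.[]≔-idempotent m t) (Vecₚ.[]≔-lookup m t))

  raise-lower : (e : Exp n) (t : Fin n) → lookup e t ≢ 0 → raise (lower e t) t ≡ e
  raise-lower e t eₜ≢0 = begin
    raise (lower e t) t                      ≡⟨ cong (λ z → lower e t [ t ]≔ suc z) (Vecₚ.lookup∘update t e _) ⟩
    lower e t [ t ]≔ suc (pred (lookup e t)) ≡⟨ Vecₚ.[]≔-idempotent e t ⟩
    e [ t ]≔ suc (pred (lookup e t))         ≡⟨ cong (e [ t ]≔_) (ℕₚ.suc-pred (lookup e t) {{Nat.≢-nonZero eₜ≢0}}) ⟩
    e [ t ]≔ lookup e t                      ≡⟨ Vecₚ.[]≔-lookup e t ⟩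
    e                                        ∎

  _⊕_ : Exp n → Exp n → Exp n
  _⊕_ = zipWith _+_

  lookup-⊕ : (u v : Exp n) (j : Fin n) → lookup (u ⊕ v) j ≡ lookup u j + lookup v j
  lookup-⊕ u v j = Vecₚ.lookup-zipWith _+_ j u v

  0ᵉ : Exp n
  0ᵉ = replicate _ 0

  single : Fin n → ℕ → Exp n
  single i j = 0ᵉ [ i ]≔ j

  single-at : (i : Fin n) (j : ℕ) → lookup (single i j) i ≡ j
  single-at i j = Vecₚ.lookup∘update i 0ᵉ j

  single-off : (i : Fin n) (j : ℕ) {k : Fin n} → k ≢ i → lookup (single i j) k ≡ 0
  single-off i j {k} k≢i = trans (Vecₚ.lookup∘update′ k≢i 0ᵉ j) (Vecₚ.lookup-replicate k 0)

  0ᵉ≡single : (i : Fin n) → 0ᵉ ≡ single i 0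
  0ᵉ≡single i = sym (trans (cong (0ᵉ [ i ]≔_) (sym (Vecₚ.lookup-replicate i 0))) (Vecₚ.[]≔-lookup 0ᵉ i))

  0ᵉ-⊕ : (v : Exp n) → 0ᵉ ⊕ v ≡ v
  0ᵉ-⊕ v = lookup-ext _ v (λ k → trans (lookup-⊕ 0ᵉ v k) (cong (_+ lookup v k) (Vecₚ.lookup-replicate k 0)))

  0ᵉ-⊕-⇔ : (v w : Exp n) → (0ᵉ ⊕ v ≡ w) ⇔ (v ≡ w)
  0ᵉ-⊕-⇔ v w = mk⇔ (trans (sym (0ᵉ-⊕ v))) (trans (0ᵉ-⊕ v))

  SupportedOn : Fin n → Exp n → Set
  SupportedOn i u = ∀ k → k ≢ i → lookup u k ≡ 0

  0ᵉ-supported : (i : Fin n) → SupportedOn i 0ᵉ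
  0ᵉ-supported i k _ = Vecₚ.lookup-replicate k 0

  single-supported : (i : Fin n) (j : ℕ) → SupportedOn i (single i j)
  single-supported i j k k≢i = single-off i j k≢i

  ⊕-supported : (i : Fin n) (u v : Exp n) → SupportedOn i u → SupportedOn i v → SupportedOn i (u ⊕ v)
  ⊕-supported i u v su sv k k≢i = trans (lookup-⊕ u v k) (cong₂ _+_ (su k k≢i) (sv k k≢i))

  supported⇒single : (i : Fin n) (u : Exp n) → SupportedOn i u → u ≡ single i (lookup u i)
  supported⇒single i u su = lookup-ext u _ at
    where
      at : ∀ k → lookup u k ≡ lookup (single i (lookup u i)) k
      at k with k ≟ᶠ i
      ... | yes refl = sym (single-at k _)
      ... | no k≢i   = trans (su k k≢i) (sym (single-off i _ k≢i))

  ⊕-split : (i : Fin n) (u v m : Exp n) → SupportedOn i u → lookup u i ≡ lookup m i → lookup v i ≡ 0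
          → (u ⊕ v ≡ m) ⇔ (v ≡ m [ i ]≔ 0)
  ⊕-split i u v m su uᵢ vᵢ = mk⇔ to from
    where
      to : u ⊕ v ≡ m → v ≡ m [ i ]≔ 0
      to eq = lookup-ext v _ at
        where
          at : ∀ k → lookup v k ≡ lookup (m [ i ]≔ 0) k
          at k with k ≟ᶠ i
          ... | yes refl = trans vᵢ (sym (Vecₚ.lookup∘update k m 0))
          ... | no k≢i   = begin
            lookup v k               ≡⟨ cong (_+ lookup v k) (sym (su k k≢i)) ⟩
            lookup u k + lookup v k  ≡⟨ sym (lookup-⊕ u v k) ⟩
            lookup (u ⊕ v) k         ≡⟨ cong (λ z → lookup z k) eq ⟩
            lookup m k               ≡⟨ sym (Vecₚ.lookup∘update′ k≢i m 0) ⟩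
            lookup (m [ i ]≔ 0) k    ∎
      from : v ≡ m [ i ]≔ 0 → u ⊕ v ≡ m
      from eq = lookup-ext _ m at
        where
          at : ∀ k → lookup (u ⊕ v) k ≡ lookup m k
          at k with k ≟ᶠ i
          ... | yes refl = trans (lookup-⊕ u v k) (trans (cong₂ _+_ uᵢ vᵢ) (ℕₚ.+-identityʳ _))
          ... | no k≢i   = trans (lookup-⊕ u v k)
                             (trans (cong₂ _+_ (su k k≢i) (cong (λ z → lookup z k) eq)) (Vecₚ.lookup∘update′ k≢i m 0))

  ⊕-split-miss : (i : Fin n) (u v m : Exp n) → lookup u i ≢ lookup m i → lookup v i ≡ 0 → u ⊕ v ≢ m
  ⊕-split-miss i u v m uᵢ≢mᵢ vᵢ eq = uᵢ≢mᵢ (begin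
    lookup u i               ≡⟨ sym (ℕₚ.+-identityʳ _) ⟩
    lookup u i + 0           ≡⟨ cong (lookup u i +_) (sym vᵢ) ⟩
    lookup u i + lookup v i  ≡⟨ sym (lookup-⊕ u v i) ⟩
    lookup (u ⊕ v) i         ≡⟨ cong (λ z → lookup z i) eq ⟩
    lookup m i               ∎)

  ⊕-single-suc : (i : Fin n) (j : ℕ) (v : Exp n) → SupportedOn i v
               → (single i 1 ⊕ v ≡ single i (suc j)) ⇔ (v ≡ single i j)
  ⊕-single-suc i j v sv = mk⇔ to from
    where
      to : single i 1 ⊕ v ≡ single i (suc j) → v ≡ single i j
      to eq = lookup-ext v _ at
        where
          at : ∀ k → lookup v k ≡ lookup (single i j) k
          at k with k ≟ᶠ i
          ... | yes refl = trans (ℕₚ.suc-injective (begin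
                  suc (lookup v k)                   ≡⟨ cong (_+ lookup v k) (sym (single-at k 1)) ⟩
                  lookup (single k 1) k + lookup v k ≡⟨ sym (lookup-⊕ (single k 1) v k) ⟩
                  lookup (single k 1 ⊕ v) k          ≡⟨ cong (λ z → lookup z k) eq ⟩
                  lookup (single k (suc j)) k        ≡⟨ single-at k (suc j) ⟩
                  suc j                              ∎)) (sym (single-at k j))
          ... | no k≢i   = trans (sv k k≢i) (sym (single-off i j k≢i))
      from : v ≡ single i j → single i 1 ⊕ v ≡ single i (suc j)
      from refl = lookup-ext _ _ at
        where
          at : ∀ k → lookup (single i 1 ⊕ single i j) k ≡ lookup (single i (suc j)) k
          at k with k ≟ᶠ i
          ... | yes refl = trans (lookup-⊕ (single k 1) _ k)
                             (trans (cong₂ _+_ (single-at k 1) (single-at k j)) (sym (single-at k (suc j))))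
          ... | no k≢i   = trans (lookup-⊕ (single i 1) _ k)
                             (trans (cong₂ _+_ (single-off i 1 k≢i) (single-off i j k≢i)) (sym (single-off i (suc j) k≢i)))

  ⊕-single-zero : (i : Fin n) (v : Exp n) → single i 1 ⊕ v ≢ single i 0
  ⊕-single-zero i v eq with trans (sym (cong (_+ lookup v i) (single-at i 1)))
                               (trans (sym (lookup-⊕ (single i 1) v i)) (trans (cong (λ z → lookup z i) eq) (single-at i 0)))
  ... | ()

module OverField {c ℓ : Level} (F : Field c ℓ) where

  open Field F hiding (zero) renaming (refl to ≈-refl; sym to ≈-sym; trans to ≈-trans)
  open import Relation.Binary.Reasoning.Setoid setoid
  open import Algebra.Solver.Ring.NaturalCoefficients.Default commutativeSemiring using (solve; _:=_; _:+_; _:*_; con)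
  open import Algebra.Properties.Ring ring using (+-identityʳ-unique)
  open Exponents

  ι : ℕ → Carrier
  ι k = natMul F k 1#

  natMul≈ι* : ∀ k x → natMul F k x ≈ ι k * x
  natMul≈ι* zero    x = ≈-sym (zeroˡ x)
  natMul≈ι* (suc k) x = begin
    x + natMul F k x  ≈⟨ +-cong (≈-sym (*-identityˡ x)) (natMul≈ι* k x) ⟩
    1# * x + ι k * x  ≈⟨ ≈-sym (distribʳ x 1# (ι k)) ⟩
    (1# + ι k) * x    ∎

  ι-+ : ∀ k l → ι (k Nat.+ l) ≈ ι k + ι l
  ι-+ zero    l = ≈-sym (+-identityˡ _)
  ι-+ (suc k) l = ≈-trans (+-congˡ (ι-+ k l)) (≈-sym (+-assoc _ _ _))

  ι-1 : ι 1 ≈ 1#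
  ι-1 = +-identityʳ 1#

  cancel-ι : ∀ k {x} → ¬ (ι k ≈ 0#) → ι k * x ≈ 0# → x ≈ 0#
  cancel-ι k {x} ιk≉0 ιkx≈0 with inverse (ι k) ιk≉0
  ... | y , ιky≈1 = begin
    x              ≈⟨ ≈-sym (*-identityˡ x) ⟩
    1# * x         ≈⟨ *-congʳ (≈-sym ιky≈1) ⟩
    (ι k * y) * x  ≈⟨ solve 3 (λ i y x → ((i :* y) :* x) := (y :* (i :* x))) ≈-refl (ι k) y x ⟩
    y * (ι k * x)  ≈⟨ *-congˡ ιkx≈0 ⟩
    y * 0#         ≈⟨ zeroʳ y ⟩
    0#             ∎

  nonzero-below-char : ∀ p d → HasChar F p → (p ≢ 0 → d < p) → ∀ k → k < d → ¬ (ι (suc k) ≈ 0#)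
  nonzero-below-char zero    d char _   k _   = char k
  nonzero-below-char (suc p) d char d<p k k<d = proj₂ char k (ℕₚ.≤-<-trans k<d (d<p (λ ())))

  when : ∀ {p} {Q : Set p} → Dec Q → Carrier → Carrier
  when (yes _) x = x
  when (no _)  x = 0#

  when-yes : ∀ {p} {Q : Set p} (d : Dec Q) {x} → Q → when d x ≡ x
  when-yes (yes _) q = refl
  when-yes (no ¬q) q = ⊥-elim (¬q q)

  when-no : ∀ {p} {Q : Set p} (d : Dec Q) {x} → ¬ Q → when d x ≡ 0#
  when-no (yes q) ¬q = ⊥-elim (¬q q)
  when-no (no _)  ¬q = refl

  ∑ : ∀ {a} {A : Set a} → List A → (A → Carrier) → Carrier
  ∑ []       g = 0#
  ∑ (x ∷ xs) g = g x + ∑ xs g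

  module _ {a} {A : Set a} where

    ∑-congᴬ : ∀ xs {g h : A → Carrier} → All (λ x → g x ≈ h x) xs → ∑ xs g ≈ ∑ xs h
    ∑-congᴬ []       []       = ≈-refl
    ∑-congᴬ (x ∷ xs) (p ∷ ps) = +-cong p (∑-congᴬ xs ps)

    ∑-cong : ∀ xs {g h : A → Carrier} → (∀ x → g x ≈ h x) → ∑ xs g ≈ ∑ xs h
    ∑-cong xs eq = ∑-congᴬ xs (All.tabulate (λ {x} _ → eq x))

    ∑-zero : ∀ xs {g : A → Carrier} → (∀ x → g x ≈ 0#) → ∑ xs g ≈ 0#
    ∑-zero []       eq = ≈-refl
    ∑-zero (x ∷ xs) eq = ≈-trans (+-cong (eq x) (∑-zero xs eq)) (+-identityˡ 0#)

    ∑-+ : ∀ xs (g h : A → Carrier) → ∑ xs (λ x → g x + h x) ≈ ∑ xs g + ∑ xs h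
    ∑-+ []       g h = ≈-sym (+-identityˡ 0#)
    ∑-+ (x ∷ xs) g h = ≈-trans (+-congˡ (∑-+ xs g h))
      (solve 4 (λ a b u v → ((a :+ b) :+ (u :+ v)) := ((a :+ u) :+ (b :+ v))) ≈-refl (g x) (h x) (∑ xs g) (∑ xs h))

    ∑-*ˡ : ∀ xs y (g : A → Carrier) → ∑ xs (λ x → y * g x) ≈ y * ∑ xs g
    ∑-*ˡ []       y g = ≈-sym (zeroʳ y)
    ∑-*ˡ (x ∷ xs) y g = ≈-trans (+-congˡ (∑-*ˡ xs y g)) (≈-sym (distribˡ y _ _))

  ∑-swap : ∀ {a b} {A : Set a} {B : Set b} (xs : List A) (ys : List B) (h : A → B → Carrier)
         → ∑ xs (λ x → ∑ ys (h x)) ≈ ∑ ys (λ y → ∑ xs (λ x → h x y))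
  ∑-swap []       ys h = ≈-sym (∑-zero ys (λ _ → ≈-refl))
  ∑-swap (x ∷ xs) ys h = ≈-trans (+-congˡ (∑-swap xs ys h)) (≈-sym (∑-+ ys (h x) _))

  sumTo : ℕ → (ℕ → Carrier) → Carrier
  sumTo zero    g = 0#
  sumTo (suc K) g = g 0 + sumTo K (λ k → g (suc k))

  sumTo-cong : ∀ K {g h} → (∀ k → g k ≈ h k) → sumTo K g ≈ sumTo K h
  sumTo-cong zero    eq = ≈-refl
  sumTo-cong (suc K) eq = +-cong (eq 0) (sumTo-cong K (λ k → eq (suc k)))

  sumTo-zero : ∀ K {g} → (∀ k → g k ≈ 0#) → sumTo K g ≈ 0#
  sumTo-zero zero    eq = ≈-refl
  sumTo-zero (suc K) eq = ≈-trans (+-cong (eq 0) (sumTo-zero K (λ k → eq (suc k)))) (+-identityˡ 0#)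

  sumTo-*ˡ : ∀ K y (g : ℕ → Carrier) → sumTo K (λ k → y * g k) ≈ y * sumTo K g
  sumTo-*ˡ zero    y g = ≈-sym (zeroʳ y)
  sumTo-*ˡ (suc K) y g = ≈-trans (+-congˡ (sumTo-*ˡ K y (λ k → g (suc k)))) (≈-sym (distribˡ y _ _))

  ∑-sumTo : ∀ {a} {A : Set a} (xs : List A) K (h : ℕ → A → Carrier)
          → ∑ xs (λ x → sumTo K (λ k → h k x)) ≈ sumTo K (λ k → ∑ xs (h k))
  ∑-sumTo xs zero    h = ∑-zero xs (λ _ → ≈-refl)
  ∑-sumTo xs (suc K) h = ≈-trans (∑-+ xs (h 0) _) (+-congˡ (∑-sumTo xs K (λ k → h (suc k))))

  sumTo-indicator : ∀ K s x v → x < K Nat.+ s → (x < s → v ≈ 0#) → sumTo K (λ k → when (x ≟ k Nat.+ s) v) ≈ v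
  sumTo-indicator zero    s x v x<s v≈0 = ≈-sym (v≈0 x<s)
  sumTo-indicator (suc K) s x v x<K+s v≈0 with x ≟ s
  ... | yes refl = ≈-trans (+-congˡ (sumTo-zero K (λ k → reflexive (when-no (x ≟ suc k Nat.+ x) (ℕₚ.<⇒≢ (ℕₚ.m<n+m x (s≤s z≤n)))))))
                           (+-identityʳ v)
  ... | no x≢s   = ≈-trans (+-identityˡ _)
                     (≈-trans (sumTo-cong K (λ k → reflexive (cong (λ z → when (x ≟ z) v) (sym (ℕₚ.+-suc k s)))))
                       (sumTo-indicator K (suc s) x v (subst (x <_) (sym (ℕₚ.+-suc K s)) x<K+s)
                         (λ x<1+s → v≈0 (ℕₚ.≤∧≢⇒< (ℕₚ.≤-pred x<1+s) x≢s))))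

  -- binom k j α is the coefficient of y^j in (y + α)^k, namely C(k,j) α^(k-j).
  binom : ℕ → ℕ → Carrier → Carrier
  binom zero    zero    α = 1#
  binom zero    (suc j) α = 0#
  binom (suc k) zero    α = α * binom k zero α
  binom (suc k) (suc j) α = binom k j α + α * binom k (suc j) α

  binom-above : ∀ k j α → k < j → binom k j α ≈ 0#
  binom-above zero    (suc j) α _         = ≈-refl
  binom-above (suc k) (suc j) α (s≤s k<j) = begin
    binom k j α + α * binom k (suc j) α ≈⟨ +-cong (binom-above k j α k<j) (*-congˡ (binom-above k (suc j) α (ℕₚ.m≤n⇒m≤1+n k<j))) ⟩
    0# + α * 0#                         ≈⟨ +-identityˡ _ ⟩
    α * 0#                              ≈⟨ zeroʳ α ⟩
    0#                                  ∎

  binom-diag : ∀ k α → binom k k α ≈ 1#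
  binom-diag zero    α = ≈-refl
  binom-diag (suc k) α = begin
    binom k k α + α * binom k (suc k) α ≈⟨ +-cong (binom-diag k α) (*-congˡ (binom-above k (suc k) α (ℕₚ.n<1+n k))) ⟩
    1# + α * 0#                         ≈⟨ +-congˡ (zeroʳ α) ⟩
    1# + 0#                             ≈⟨ +-identityʳ 1# ⟩
    1#                                  ∎

  -- 1 + (k - (j+1)) = k - j as long as C(k, j+1) ≠ 0.
  binom-gap : ∀ k j α → ι (suc (k Nat.∸ suc j)) * binom k (suc j) α ≈ ι (k Nat.∸ j) * binom k (suc j) α
  binom-gap k j α with j <? k
  ... | yes j<k = reflexive (cong (λ z → ι z * binom k (suc j) α) (suc-∸ k j j<k))
    where
      suc-∸ : ∀ k j → j < k → suc (k Nat.∸ suc j) ≡ k Nat.∸ j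
      suc-∸ (suc k) zero    _         = refl
      suc-∸ (suc k) (suc j) (s≤s j<k) = suc-∸ k j j<k
  ... | no j≮k  = ≈-trans (*-congˡ vanishes) (≈-trans (zeroʳ _) (≈-sym (≈-trans (*-congˡ vanishes) (zeroʳ _))))
    where
      vanishes : binom k (suc j) α ≈ 0#
      vanishes = binom-above k (suc j) α (s≤s (ℕₚ.≮⇒≥ j≮k))

  -- The derivative identity  α (j+1) C(k,j+1) α^(k-j-1) = (k-j) C(k,j) α^(k-j),
  -- i.e. d/dy (y + α)^k = k (y + α)^(k-1) read coefficientwise.
  binom-shift : ∀ k j α → α * (ι (suc j) * binom k (suc j) α) ≈ ι (k Nat.∸ j) * binom k j α
  binom-shift zero j α = begin
    α * (ι (suc j) * 0#)        ≈⟨ ≈-trans (*-congˡ (zeroʳ _)) (zeroʳ α) ⟩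
    0#                          ≈⟨ ≈-sym (zeroˡ _) ⟩
    0# * binom zero j α         ≈⟨ *-congʳ (reflexive (cong ι (sym (ℕₚ.0∸n≡0 j)))) ⟩
    ι (0 Nat.∸ j) * binom zero j α ∎
  binom-shift (suc k) zero α = begin
    α * (ι 1 * (B₀ + α * B₁))                ≈⟨ solve 4 (λ a i x y → (a :* (i :* (x :+ a :* y))) := (a :* (i :* x) :+ a :* (a :* (i :* y)))) ≈-refl α (ι 1) B₀ B₁ ⟩
    α * (ι 1 * B₀) + α * (α * (ι 1 * B₁))    ≈⟨ +-cong (*-congˡ (≈-trans (*-congʳ ι-1) (*-identityˡ B₀))) (*-congˡ (binom-shift k zero α)) ⟩
    α * B₀ + α * (ι k * B₀)                  ≈⟨ solve 3 (λ a x i → (a :* x :+ a :* (i :* x)) := ((con 1 :+ i) :* (a :* x))) ≈-refl α B₀ (ι k) ⟩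
    ι (suc k) * (α * B₀)                     ∎
    where
      B₀ B₁ : Carrier
      B₀ = binom k 0 α
      B₁ = binom k 1 α
  binom-shift (suc k) (suc j) α = begin
    α * ((1# + ι (suc j)) * (B₁ + α * B₂))
      ≈⟨ solve 4 (λ a i x y → (a :* ((con 1 :+ i) :* (x :+ a :* y))) := (a :* (i :* x) :+ (a :* x :+ a :* (a :* ((con 1 :+ i) :* y))))) ≈-refl α (ι (suc j)) B₁ B₂ ⟩
    α * (ι (suc j) * B₁) + (α * B₁ + α * (α * (ι (suc (suc j)) * B₂)))
      ≈⟨ +-cong (binom-shift k j α) (+-congˡ (*-congˡ (binom-shift k (suc j) α))) ⟩
    ι (k Nat.∸ j) * B₀ + (α * B₁ + α * (ι (k Nat.∸ suc j) * B₁))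
      ≈⟨ +-congˡ (solve 3 (λ a h x → (a :* x :+ a :* (h :* x)) := (a :* ((con 1 :+ h) :* x))) ≈-refl α (ι (k Nat.∸ suc j)) B₁) ⟩
    ι (k Nat.∸ j) * B₀ + α * (ι (suc (k Nat.∸ suc j)) * B₁)
      ≈⟨ +-congˡ (*-congˡ (binom-gap k j α)) ⟩
    ι (k Nat.∸ j) * B₀ + α * (ι (k Nat.∸ j) * B₁)
      ≈⟨ solve 4 (λ g a x y → (g :* x :+ a :* (g :* y)) := (g :* (x :+ a :* y))) ≈-refl (ι (k Nat.∸ j)) α B₀ B₁ ⟩
    ι (k Nat.∸ j) * (B₀ + α * B₁) ∎
    where
      B₀ B₁ B₂ : Carrier
      B₀ = binom k j α
      B₁ = binom k (suc j) α
      B₂ = binom k (suc (suc j)) α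

  module _ {n : ℕ} where

    coeff-cons : ∀ γ (e : Exp n) f m → coeff F ((γ , e) ∷ f) m ≈ when (≡-dec _≟_ e m) γ + coeff F f m
    coeff-cons γ e f m with ≡-dec _≟_ e m
    ... | yes _ = ≈-refl
    ... | no _  = ≈-sym (+-identityˡ _)

    coeff-++ : ∀ (p q : Poly F n) m → coeff F (p ++ q) m ≈ coeff F p m + coeff F q m
    coeff-++ []            q m = ≈-sym (+-identityˡ _)
    coeff-++ ((γ , e) ∷ p) q m with ≡-dec _≟_ e m
    ... | yes _ = ≈-trans (+-congˡ (coeff-++ p q m)) (≈-sym (+-assoc _ _ _))
    ... | no _  = coeff-++ p q m

    coeff-concatMap : ∀ {a} {A : Set a} (xs : List A) (g : A → Poly F n) m
                    → coeff F (concatMap g xs) m ≈ ∑ xs (λ x → coeff F (g x) m)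
    coeff-concatMap []       g m = ≈-refl
    coeff-concatMap (x ∷ xs) g m = ≈-trans (coeff-++ (g x) (concatMap g xs) m) (+-congˡ (coeff-concatMap xs g m))

    coeff-scale : ∀ b (p : Poly F n) m → coeff F (scale F b p) m ≈ b * coeff F p m
    coeff-scale b []            m = ≈-sym (zeroʳ b)
    coeff-scale b ((γ , e) ∷ p) m with ≡-dec _≟_ e m
    ... | yes _ = ≈-trans (+-congˡ (coeff-scale b p m)) (≈-sym (distribˡ b _ _))
    ... | no _  = coeff-scale b p m

    -- The coefficient of x^m in ∂f/∂xₜ is (mₜ + 1) times that of x^(m + eₜ) in f:
    -- a term b x^e lands on x^m exactly when e = m + eₜ, except that terms with
    -- eₜ = 0 also land on x^(lower e t) but carry the factor eₜ = 0.
    coeff-partial : ∀ t (f : Poly F n) m → coeff F (partial F t f) m ≈ ι (suc (lookup m t)) * coeff F f (raise m t)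
    coeff-partial t [] m = ≈-sym (zeroʳ _)
    coeff-partial t ((b , e) ∷ f) m with ≡-dec _≟_ (lower e t) m | ≡-dec _≟_ e (raise m t)
    ... | yes _     | yes e≡m+eₜ = begin
      natMul F (lookup e t) b + coeff F (partial F t f) m
        ≈⟨ +-cong (natMul≈ι* (lookup e t) b) (coeff-partial t f m) ⟩
      ι (lookup e t) * b + ι (suc (lookup m t)) * coeff F f (raise m t)
        ≈⟨ +-congʳ (*-congʳ (reflexive (cong ι eₜ))) ⟩
      ι (suc (lookup m t)) * b + ι (suc (lookup m t)) * coeff F f (raise m t)
        ≈⟨ ≈-sym (distribˡ _ _ _) ⟩
      ι (suc (lookup m t)) * (b + coeff F f (raise m t)) ∎
      where
        eₜ : lookup e t ≡ suc (lookup m t)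
        eₜ = trans (cong (λ z → lookup z t) e≡m+eₜ) (Vecₚ.lookup∘update t m _)
    ... | no lower≢m | yes e≡m+eₜ = ⊥-elim (lower≢m (trans (cong (λ z → lower z t) e≡m+eₜ) (lower-raise m t)))
    ... | no _       | no _       = coeff-partial t f m
    ... | yes lower≡m | no e≢m+eₜ with lookup e t ≟ 0
    ...   | yes eₜ≡0 = ≈-trans (+-congʳ (≈-trans (natMul≈ι* (lookup e t) b) (≈-trans (*-congʳ (reflexive (cong ι eₜ≡0))) (zeroˡ b))))
                               (≈-trans (+-identityˡ _) (coeff-partial t f m))
    ...   | no eₜ≢0  = ⊥-elim (e≢m+eₜ (trans (sym (raise-lower e t eₜ≢0)) (cong (λ z → raise z t) lower≡m)))

    ⟪_∣_⟫ : Poly F n → (Exp n → Carrier) → Carrier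
    ⟪ f ∣ h ⟫ = ∑ f (λ term → proj₁ term * h (proj₂ term))

    pair-congᴬ : ∀ f {h h' : Exp n → Carrier} → All (λ term → h (proj₂ term) ≈ h' (proj₂ term)) f → ⟪ f ∣ h ⟫ ≈ ⟪ f ∣ h' ⟫
    pair-congᴬ f eqs = ∑-congᴬ f (All.map (λ eq → *-congˡ eq) eqs)

    pair-cong : ∀ f {h h' : Exp n → Carrier} → (∀ e → h e ≈ h' e) → ⟪ f ∣ h ⟫ ≈ ⟪ f ∣ h' ⟫
    pair-cong f eq = ∑-cong f (λ term → *-congˡ (eq (proj₂ term)))

    pair-*ˡ : ∀ f y (h : Exp n → Carrier) → ⟪ f ∣ (λ e → y * h e) ⟫ ≈ y * ⟪ f ∣ h ⟫
    pair-*ˡ f y h = ≈-trans (∑-cong f (λ term → solve 3 (λ g y z → (g :* (y :* z)) := (y :* (g :* z))) ≈-refl (proj₁ term) y (h (proj₂ term))))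
                            (∑-*ˡ f y _)

    pair-∑ : ∀ {a} {A : Set a} f (xs : List A) (h : A → Exp n → Carrier)
           → ⟪ f ∣ (λ e → ∑ xs (λ x → h x e)) ⟫ ≈ ∑ xs (λ x → ⟪ f ∣ h x ⟫)
    pair-∑ f xs h = ≈-trans (∑-cong f (λ term → ≈-sym (∑-*ˡ xs (proj₁ term) (λ x → h x (proj₂ term))))) (∑-swap f xs _)

    pair-sumTo : ∀ f K (h : ℕ → Exp n → Carrier) → ⟪ f ∣ (λ e → sumTo K (λ k → h k e)) ⟫ ≈ sumTo K (λ k → ⟪ f ∣ h k ⟫)
    pair-sumTo f K h = ≈-trans (∑-cong f (λ term → ≈-sym (sumTo-*ˡ K (proj₁ term) (λ k → h k (proj₂ term))))) (∑-sumTo f K _)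

    coeff-as-pair : ∀ f m → coeff F f m ≈ ⟪ f ∣ (λ e → when (≡-dec _≟_ e m) 1#) ⟫
    coeff-as-pair []            m = ≈-refl
    coeff-as-pair ((γ , e) ∷ f) m with ≡-dec _≟_ e m
    ... | yes _ = +-cong (≈-sym (*-identityʳ γ)) (coeff-as-pair f m)
    ... | no _  = ≈-trans (coeff-as-pair f m) (≈-trans (≈-sym (+-identityˡ _)) (+-congʳ (≈-sym (zeroʳ γ))))

    ∑-pick : ∀ E e γ (h : Exp n → Carrier) → e ∈ E → Unique E → ∑ E (λ x → when (≡-dec _≟_ e x) γ * h x) ≈ γ * h e
    ∑-pick (x ∷ E) e γ h (here refl) (e∉E ∷ _) = ≈-trans (+-cong (*-congʳ (reflexive (when-yes (≡-dec _≟_ e e) refl))) others) (+-identityʳ _)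
      where
        others : ∑ E (λ x → when (≡-dec _≟_ e x) γ * h x) ≈ 0#
        others = ≈-trans (∑-congᴬ E (All.map (λ e≢x → ≈-trans (*-congʳ (reflexive (when-no (≡-dec _≟_ e _) e≢x))) (zeroˡ _)) e∉E))
                         (∑-zero E (λ _ → ≈-refl))
    ∑-pick (x ∷ E) e γ h (there e∈E) (x∉E ∷ unique) =
      ≈-trans (+-cong (≈-trans (*-congʳ (reflexive (when-no (≡-dec _≟_ e x) (λ e≡x → All.lookup x∉E e∈E (sym e≡x))))) (zeroˡ _))
                      (∑-pick E e γ h e∈E unique))
              (+-identityˡ _)

    pair-by-exponents : ∀ f E (h : Exp n → Carrier) → Unique E → All (λ term → proj₂ term ∈ E) f
                      → ⟪ f ∣ h ⟫ ≈ ∑ E (λ e → coeff F f e * h e)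
    pair-by-exponents []            E h _      _          = ≈-sym (∑-zero E (λ _ → zeroˡ _))
    pair-by-exponents ((γ , e) ∷ f) E h unique (e∈E ∷ f⊆E) = begin
      γ * h e + ⟪ f ∣ h ⟫
        ≈⟨ +-cong (≈-sym (∑-pick E e γ h e∈E unique)) (pair-by-exponents f E h unique f⊆E) ⟩
      ∑ E (λ x → when (≡-dec _≟_ e x) γ * h x) + ∑ E (λ x → coeff F f x * h x)
        ≈⟨ ≈-sym (∑-+ E _ _) ⟩
      ∑ E (λ x → when (≡-dec _≟_ e x) γ * h x + coeff F f x * h x)
        ≈⟨ ∑-cong E (λ x → ≈-trans (≈-sym (distribʳ (h x) _ _)) (*-congʳ (≈-sym (coeff-cons γ e f x)))) ⟩
      ∑ E (λ x → coeff F ((γ , e) ∷ f) x * h x) ∎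

    -- ⟪ f ∣ h ⟫ vanishes when at every exponent either the coefficient of f or h does.
    -- Terms of f may cancel, so this has to go through the grouped form above.
    pair-vanish : ∀ f (h : Exp n → Carrier) → (∀ e → (coeff F f e ≈ 0#) ⊎ (h e ≈ 0#)) → ⟪ f ∣ h ⟫ ≈ 0#
    pair-vanish f h vanish =
      ≈-trans (pair-by-exponents f E h (DecUniqueₚ.deduplicate-! (≡-dec _≟_) exponents)
                                 (All.tabulate (λ term∈f → ∈ₚ.∈-deduplicate⁺ (≡-dec _≟_) (∈ₚ.∈-map⁺ proj₂ term∈f))))
              (∑-zero E (λ e → product-vanishes e (vanish e)))
      where
        exponents : List (Exp n)
        exponents = map proj₂ f
        E : List (Exp n)
        E = List.deduplicate (≡-dec _≟_) exponents
        product-vanishes : ∀ e → (coeff F f e ≈ 0#) ⊎ (h e ≈ 0#) → coeff F f e * h e ≈ 0#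
        product-vanishes e (inj₁ c≈0) = ≈-trans (*-congʳ c≈0) (zeroˡ _)
        product-vanishes e (inj₂ h≈0) = ≈-trans (*-congˡ h≈0) (zeroʳ _)

    infixl 7 _⊠_
    _⊠_ : Poly F n → Poly F n → Poly F n
    p ⊠ q = _*ₚ_ F p q

    coeff-⊠-cons : ∀ β u (P Q : Poly F n) m
                 → coeff F (((β , u) ∷ P) ⊠ Q) m ≈ coeff F (((β , u) ∷ []) ⊠ Q) m + coeff F (P ⊠ Q) m
    coeff-⊠-cons β u P Q m = ≈-trans (coeff-++ uQ (P ⊠ Q) m) (+-congʳ (≈-trans (≈-sym (+-identityʳ _)) (≈-sym (coeff-++ uQ [] m))))
      where
        uQ : Poly F n
        uQ = map (λ term → (β * proj₁ term , u ⊕ proj₂ term)) Q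

    coeff-term-⊠ : ∀ β u (Q : Poly F n) m w → All (λ term → (u ⊕ proj₂ term ≡ m) ⇔ (proj₂ term ≡ w)) Q
                 → coeff F (((β , u) ∷ []) ⊠ Q) m ≈ β * coeff F Q w
    coeff-term-⊠ β u []            m w _ = ≈-sym (zeroʳ β)
    coeff-term-⊠ β u ((b , v) ∷ Q) m w (hit⇔ ∷ hits⇔) = begin
      coeff F ((β * b , u ⊕ v) ∷ (((β , u) ∷ []) ⊠ Q)) m
        ≈⟨ coeff-cons (β * b) (u ⊕ v) (((β , u) ∷ []) ⊠ Q) m ⟩
      when (≡-dec _≟_ (u ⊕ v) m) (β * b) + coeff F (((β , u) ∷ []) ⊠ Q) m
        ≈⟨ +-cong head (coeff-term-⊠ β u Q m w hits⇔) ⟩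
      β * when (≡-dec _≟_ v w) b + β * coeff F Q w ≈⟨ ≈-sym (distribˡ β _ _) ⟩
      β * (when (≡-dec _≟_ v w) b + coeff F Q w)  ≈⟨ *-congˡ (≈-sym (coeff-cons b v Q w)) ⟩
      β * coeff F ((b , v) ∷ Q) w                 ∎
      where
        head : when (≡-dec _≟_ (u ⊕ v) m) (β * b) ≈ β * when (≡-dec _≟_ v w) b
        head with ≡-dec _≟_ (u ⊕ v) m | ≡-dec _≟_ v w
        ... | yes _   | yes _   = ≈-refl
        ... | yes hit | no v≢w  = ⊥-elim (v≢w (Equivalence.to hit⇔ hit))
        ... | no miss | yes v≡w = ⊥-elim (miss (Equivalence.from hit⇔ v≡w))
        ... | no _    | no _    = ≈-sym (zeroʳ β)

    coeff-term-⊠-miss : ∀ β u (Q : Poly F n) m → All (λ term → u ⊕ proj₂ term ≢ m) Q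
                      → coeff F (((β , u) ∷ []) ⊠ Q) m ≈ 0#
    coeff-term-⊠-miss β u []            m _              = ≈-refl
    coeff-term-⊠-miss β u ((b , v) ∷ Q) m (miss ∷ misses) =
      ≈-trans (coeff-cons (β * b) (u ⊕ v) (((β , u) ∷ []) ⊠ Q) m)
        (≈-trans (+-cong (reflexive (when-no (≡-dec _≟_ (u ⊕ v) m) miss)) (coeff-term-⊠-miss β u Q m misses)) (+-identityˡ 0#))

    ⊠-All : ∀ {P₁ P₂ P₃ : Exp n → Set} → (∀ {u v} → P₁ u → P₂ v → P₃ (u ⊕ v))
          → ∀ p q → All (λ term → P₁ (proj₂ term)) p → All (λ term → P₂ (proj₂ term)) q → All (λ term → P₃ (proj₂ term)) (p ⊠ q)
    ⊠-All combine []      q _          _  = []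
    ⊠-All combine (_ ∷ p) q (pᵤ ∷ pₚ) q₂ = Allₚ.++⁺ (Allₚ.map⁺ (All.map (combine pᵤ) q₂)) (⊠-All combine p q pₚ q₂)

    coeff-⊠-separated : ∀ i (P Q : Poly F n) m
                      → All (λ term → SupportedOn i (proj₂ term)) P → All (λ term → lookup (proj₂ term) i ≡ 0) Q
                      → coeff F (P ⊠ Q) m ≈ coeff F P (single i (lookup m i)) * coeff F Q (m [ i ]≔ 0)
    coeff-⊠-separated i []            Q m _          _     = ≈-sym (zeroˡ _)
    coeff-⊠-separated i ((β , u) ∷ P) Q m (sᵤ ∷ P-supp) Q-free = begin
      coeff F (((β , u) ∷ P) ⊠ Q) m                        ≈⟨ coeff-⊠-cons β u P Q m ⟩
      coeff F (((β , u) ∷ []) ⊠ Q) m + coeff F (P ⊠ Q) m  ≈⟨ +-cong head (coeff-⊠-separated i P Q m P-supp Q-free) ⟩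
      when (≡-dec _≟_ u mᵢ) β * cQ + coeff F P mᵢ * cQ    ≈⟨ ≈-sym (distribʳ cQ _ _) ⟩
      (when (≡-dec _≟_ u mᵢ) β + coeff F P mᵢ) * cQ       ≈⟨ *-congʳ (≈-sym (coeff-cons β u P mᵢ)) ⟩
      coeff F ((β , u) ∷ P) mᵢ * cQ                        ∎
      where
        mᵢ : Exp n
        mᵢ = single i (lookup m i)
        cQ : Carrier
        cQ = coeff F Q (m [ i ]≔ 0)
        head : coeff F (((β , u) ∷ []) ⊠ Q) m ≈ when (≡-dec _≟_ u mᵢ) β * cQ
        head with ≡-dec _≟_ u mᵢ
        ... | yes u≡mᵢ = coeff-term-⊠ β u Q m (m [ i ]≔ 0) (All.map (λ {term} vᵢ → ⊕-split i u (proj₂ term) m sᵤ uᵢ vᵢ) Q-free)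
          where
            uᵢ : lookup u i ≡ lookup m i
            uᵢ = trans (cong (λ z → lookup z i) u≡mᵢ) (single-at i _)
        ... | no u≢mᵢ  = ≈-trans (coeff-term-⊠-miss β u Q m (All.map (λ {term} vᵢ → ⊕-split-miss i u (proj₂ term) m uᵢ≢mᵢ vᵢ) Q-free))
                                 (≈-sym (zeroˡ _))
          where
            uᵢ≢mᵢ : lookup u i ≢ lookup m i
            uᵢ≢mᵢ uᵢ≡mᵢ = u≢mᵢ (trans (supported⇒single i u sᵤ) (cong (single i) uᵢ≡mᵢ))

  module Translation {n : ℕ} (a : Fin n → Carrier) where

    shift : Fin n → Poly F n
    shift i = _+ₚ_ F (var F i) (const F (a i))

    pow-supported : ∀ i k → All (λ term → SupportedOn i (proj₂ term)) (powₚ F (shift i) k)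
    pow-supported i zero    = 0ᵉ-supported i ∷ []
    pow-supported i (suc k) = ⊠-All (λ {u} {v} → ⊕-supported i u v) (shift i) (powₚ F (shift i) k)
                                    (single-supported i 1 ∷ 0ᵉ-supported i ∷ []) (pow-supported i k)

    coeff-pow-shift : ∀ i k j → coeff F (powₚ F (shift i) k) (single i j) ≈ binom k j (a i)
    coeff-pow-shift i zero zero = ≈-trans (coeff-cons 1# 0ᵉ [] (single i 0))
      (≈-trans (+-congʳ (reflexive (when-yes (≡-dec _≟_ 0ᵉ (single i 0)) (0ᵉ≡single i)))) (+-identityʳ 1#))
    coeff-pow-shift i zero (suc j) = ≈-trans (coeff-cons 1# 0ᵉ [] (single i (suc j)))
      (≈-trans (+-congʳ (reflexive (when-no (≡-dec _≟_ 0ᵉ (single i (suc j))) 0ᵉ≢xᵢ^j+1))) (+-identityʳ 0#))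
      where
        0ᵉ≢xᵢ^j+1 : 0ᵉ ≢ single i (suc j)
        0ᵉ≢xᵢ^j+1 eq with trans (sym (Vecₚ.lookup-replicate i 0)) (trans (cong (λ z → lookup z i) eq) (single-at i (suc j)))
        ... | ()
    coeff-pow-shift i (suc k) zero = begin
      coeff F (shift i ⊠ R) (single i 0)
        ≈⟨ coeff-⊠-cons 1# (single i 1) ((a i , 0ᵉ) ∷ []) R (single i 0) ⟩
      coeff F (((1# , single i 1) ∷ []) ⊠ R) (single i 0) + coeff F (((a i , 0ᵉ) ∷ []) ⊠ R) (single i 0)
        ≈⟨ +-cong (coeff-term-⊠-miss 1# (single i 1) R (single i 0) (All.tabulate (λ {term} _ → ⊕-single-zero i (proj₂ term))))
                  (coeff-term-⊠ (a i) 0ᵉ R (single i 0) (single i 0) (All.tabulate (λ {term} _ → 0ᵉ-⊕-⇔ (proj₂ term) (single i 0)))) ⟩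
      0# + a i * coeff F R (single i 0)
        ≈⟨ ≈-trans (+-identityˡ _) (*-congˡ (coeff-pow-shift i k zero)) ⟩
      a i * binom k zero (a i) ∎
      where
        R : Poly F n
        R = powₚ F (shift i) k
    coeff-pow-shift i (suc k) (suc j) = begin
      coeff F (shift i ⊠ R) (single i (suc j))
        ≈⟨ coeff-⊠-cons 1# (single i 1) ((a i , 0ᵉ) ∷ []) R (single i (suc j)) ⟩
      coeff F (((1# , single i 1) ∷ []) ⊠ R) (single i (suc j)) + coeff F (((a i , 0ᵉ) ∷ []) ⊠ R) (single i (suc j))
        ≈⟨ +-cong (coeff-term-⊠ 1# (single i 1) R (single i (suc j)) (single i j)
                     (All.map (λ {term} sᵥ → ⊕-single-suc i j (proj₂ term) sᵥ) (pow-supported i k)))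
                  (coeff-term-⊠ (a i) 0ᵉ R (single i (suc j)) (single i (suc j)) (All.tabulate (λ {term} _ → 0ᵉ-⊕-⇔ (proj₂ term) (single i (suc j))))) ⟩
      1# * coeff F R (single i j) + a i * coeff F R (single i (suc j))
        ≈⟨ +-cong (≈-trans (*-identityˡ _) (coeff-pow-shift i k j)) (*-congˡ (coeff-pow-shift i k (suc j))) ⟩
      binom k j (a i) + a i * binom k (suc j) (a i) ∎
      where
        R : Poly F n
        R = powₚ F (shift i) k

    weightOver : List (Fin n) → Exp n → Exp n → Carrier
    weightOver []      e m = 1#
    weightOver (i ∷ L) e m = binom (lookup e i) (lookup m i) (a i) * weightOver L e m

    weight : Exp n → Exp n → Carrier
    weight = weightOver (allFin n)

    weightOver-update : ∀ L e m t x → All (t ≢_) L → weightOver L e (m [ t ]≔ x) ≡ weightOver L e m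
    weightOver-update []      e m t x _            = refl
    weightOver-update (i ∷ L) e m t x (t≢i ∷ t∉L) =
      cong₂ (λ u v → binom (lookup e i) u (a i) * v) (Vecₚ.lookup∘update′ (λ i≡t → t≢i (sym i≡t)) m x) (weightOver-update L e m t x t∉L)

    termTranslate : Carrier → Exp n → List (Fin n) → Poly F n
    termTranslate γ e L = foldr (λ i acc → powₚ F (shift i) (lookup e i) ⊠ acc) (const F γ) L

    termTranslate-free : ∀ γ e L → All (λ term → ∀ j → All (j ≢_) L → lookup (proj₂ term) j ≡ 0) (termTranslate γ e L)
    termTranslate-free γ e []      = (λ j _ → Vecₚ.lookup-replicate j 0) ∷ []
    termTranslate-free γ e (i ∷ L) = ⊠-All (λ {u} {v} → combine {u} {v}) (powₚ F (shift i) (lookup e i)) (termTranslate γ e L)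
                                           (pow-supported i (lookup e i)) (termTranslate-free γ e L)
      where
        combine : ∀ {u v} → SupportedOn i u → (∀ j → All (j ≢_) L → lookup v j ≡ 0) → ∀ j → All (j ≢_) (i ∷ L) → lookup (u ⊕ v) j ≡ 0
        combine {u} {v} sᵤ v-free j (j≢i ∷ j∉L) = trans (lookup-⊕ u v j) (cong₂ Nat._+_ (sᵤ j j≢i) (v-free j j∉L))

    clear : List (Fin n) → Exp n → Exp n
    clear []      m = m
    clear (i ∷ L) m = clear L (m [ i ]≔ 0)

    coeff-termTranslate : ∀ γ e L m → Unique L → coeff F (termTranslate γ e L) m ≈ weightOver L e m * coeff F (const F γ) (clear L m)
    coeff-termTranslate γ e []      m _ = ≈-sym (*-identityˡ _)
    coeff-termTranslate γ e (i ∷ L) m (i∉L ∷ unique) = begin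
      coeff F (Pᵢ ⊠ termTranslate γ e L) m
        ≈⟨ coeff-⊠-separated i Pᵢ (termTranslate γ e L) m (pow-supported i (lookup e i)) (All.map (λ free → free i i∉L) (termTranslate-free γ e L)) ⟩
      coeff F Pᵢ (single i (lookup m i)) * coeff F (termTranslate γ e L) (m [ i ]≔ 0)
        ≈⟨ *-cong (coeff-pow-shift i (lookup e i) (lookup m i)) (coeff-termTranslate γ e L (m [ i ]≔ 0) unique) ⟩
      bᵢ * (weightOver L e (m [ i ]≔ 0) * cγ)
        ≈⟨ *-congˡ (*-congʳ (reflexive (weightOver-update L e m i 0 i∉L))) ⟩
      bᵢ * (weightOver L e m * cγ)
        ≈⟨ ≈-sym (*-assoc _ _ _) ⟩
      bᵢ * weightOver L e m * cγ ∎
      where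
        Pᵢ : Poly F n
        Pᵢ = powₚ F (shift i) (lookup e i)
        bᵢ cγ : Carrier
        bᵢ = binom (lookup e i) (lookup m i) (a i)
        cγ = coeff F (const F γ) (clear L (m [ i ]≔ 0))

    clear-keeps-zero : ∀ L m j → lookup m j ≡ 0 → lookup (clear L m) j ≡ 0
    clear-keeps-zero []      m j mⱼ≡0 = mⱼ≡0
    clear-keeps-zero (i ∷ L) m j mⱼ≡0 = clear-keeps-zero L (m [ i ]≔ 0) j still-zero
      where
        still-zero : lookup (m [ i ]≔ 0) j ≡ 0
        still-zero with j ≟ᶠ i
        ... | yes refl = Vecₚ.lookup∘update j m 0
        ... | no j≢i   = trans (Vecₚ.lookup∘update′ j≢i m 0) mⱼ≡0

    clear-zeroes : ∀ L m j → j ∈ L → lookup (clear L m) j ≡ 0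
    clear-zeroes (i ∷ L) m j (here refl) = clear-keeps-zero L (m [ j ]≔ 0) j (Vecₚ.lookup∘update j m 0)
    clear-zeroes (i ∷ L) m j (there j∈L) = clear-zeroes L (m [ i ]≔ 0) j j∈L

    clear-all : ∀ m → clear (allFin n) m ≡ 0ᵉ
    clear-all m = lookup-ext _ _ (λ j → trans (clear-zeroes (allFin n) m j (∈ₚ.∈-allFin j)) (sym (Vecₚ.lookup-replicate j 0)))

    coeff-const : ∀ γ → coeff F (const F {n} γ) 0ᵉ ≈ γ
    coeff-const γ = ≈-trans (coeff-cons γ (0ᵉ {n}) [] 0ᵉ) (≈-trans (+-congʳ (reflexive (when-yes (≡-dec _≟_ (0ᵉ {n}) 0ᵉ) refl))) (+-identityʳ γ))

    coeff-translate : ∀ f m → coeff F (translate F a f) m ≈ ⟪ f ∣ (λ e → weight e m) ⟫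
    coeff-translate []            m = ≈-refl
    coeff-translate ((γ , e) ∷ f) m = ≈-trans (coeff-++ (termTranslate γ e (allFin n)) (translate F a f) m)
                                              (+-cong term (coeff-translate f m))
      where
        term : coeff F (termTranslate γ e (allFin n)) m ≈ γ * weight e m
        term = begin
          coeff F (termTranslate γ e (allFin n)) m                  ≈⟨ coeff-termTranslate γ e (allFin n) m (Uniqueₚ.allFin⁺ n) ⟩
          weight e m * coeff F (const F γ) (clear (allFin n) m)    ≈⟨ *-congˡ (≈-trans (reflexive (cong (coeff F (const F γ)) (clear-all m))) (coeff-const γ)) ⟩
          weight e m * γ                                            ≈⟨ *-comm _ _ ⟩
          γ * weight e m                                            ∎

    ∇ : (Exp n → Carrier) → Exp n → Carrier
    ∇ g m = ∑ (allFin n) (λ t → a t * (ι (suc (lookup m t)) * g (raise m t)))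

    ∇-cong : ∀ (g g' : Exp n → Carrier) m → (∀ t → g (raise m t) ≈ g' (raise m t)) → ∇ g m ≈ ∇ g' m
    ∇-cong g g' m eq = ∑-cong (allFin n) (λ t → *-congˡ (*-congˡ (eq t)))

    ∇-vanish : ∀ (g : Exp n → Carrier) m → (∀ t → g (raise m t) ≈ 0#) → ∇ g m ≈ 0#
    ∇-vanish g m vanish = ∑-zero (allFin n) (λ t → ≈-trans (*-congˡ (≈-trans (*-congˡ (vanish t)) (zeroʳ _))) (zeroʳ _))

    coeff-dirDeriv : ∀ f m → coeff F (dirDeriv F a f) m ≈ ∇ (coeff F f) m
    coeff-dirDeriv f m = ≈-trans (coeff-concatMap (allFin n) (λ t → scale F (a t) (partial F t f)) m)
      (∑-cong (allFin n) (λ t → ≈-trans (coeff-scale (a t) (partial F t f) m) (*-congˡ (coeff-partial t f m))))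

    weightOver-vanish : ∀ L e m j → j ∈ L → lookup e j < lookup m j → weightOver L e m ≈ 0#
    weightOver-vanish (i ∷ L) e m j (here refl) eⱼ<mⱼ = ≈-trans (*-congʳ (binom-above _ _ _ eⱼ<mⱼ)) (zeroˡ _)
    weightOver-vanish (i ∷ L) e m j (there j∈L) eⱼ<mⱼ = ≈-trans (*-congˡ (weightOver-vanish L e m j j∈L eⱼ<mⱼ)) (zeroʳ _)

    weight-below : ∀ e m → (∃ λ j → lookup e j < lookup m j) → weight e m ≈ 0#
    weight-below e m (j , eⱼ<mⱼ) = weightOver-vanish (allFin n) e m j (∈ₚ.∈-allFin j) eⱼ<mⱼ

    weight-diag : ∀ m → weight m m ≈ 1#
    weight-diag m = diag (allFin n)
      where
        diag : ∀ L → weightOver L m m ≈ 1#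
        diag []      = ≈-refl
        diag (i ∷ L) = ≈-trans (*-cong (binom-diag (lookup m i) (a i)) (diag L)) (*-identityˡ 1#)

    weightOver-∇ : ∀ L e m → Unique L →
      ∑ L (λ t → a t * (ι (suc (lookup m t)) * weightOver L e (raise m t)))
        ≈ ι (sumᴸ (map (λ t → lookup e t Nat.∸ lookup m t) L)) * weightOver L e m
    weightOver-∇ []      e m _ = ≈-sym (zeroˡ _)
    weightOver-∇ (i ∷ L) e m (i∉L ∷ unique) = begin
      a i * (ι (suc mᵢ) * (binom eᵢ (lookup (raise m i) i) (a i) * weightOver L e (raise m i)))
        + ∑ L (λ t → a t * (ι (suc (lookup m t)) * (binom eᵢ (lookup (raise m t) i) (a i) * weightOver L e (raise m t))))
        ≈⟨ +-cong (reflexive (cong₂ (λ u v → a i * (ι (suc mᵢ) * (binom eᵢ u (a i) * v)))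
                                    (Vecₚ.lookup∘update i m (suc mᵢ)) (weightOver-update L e m i (suc mᵢ) i∉L)))
                  (∑-congᴬ L (All.map (λ {t} i≢t → other t i≢t) i∉L)) ⟩
      a i * (ι (suc mᵢ) * (binom eᵢ (suc mᵢ) (a i) * W))
        + ∑ L (λ t → bᵢ * (a t * (ι (suc (lookup m t)) * weightOver L e (raise m t))))
        ≈⟨ +-cong (solve 4 (λ x y z w → (x :* (y :* (z :* w))) := ((x :* (y :* z)) :* w)) ≈-refl (a i) (ι (suc mᵢ)) (binom eᵢ (suc mᵢ) (a i)) W)
                  (∑-*ˡ L bᵢ _) ⟩
      (a i * (ι (suc mᵢ) * binom eᵢ (suc mᵢ) (a i))) * W + bᵢ * ∑ L (λ t → a t * (ι (suc (lookup m t)) * weightOver L e (raise m t)))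
        ≈⟨ +-cong (*-congʳ (binom-shift eᵢ mᵢ (a i))) (*-congˡ (weightOver-∇ L e m unique)) ⟩
      (ι (eᵢ Nat.∸ mᵢ) * bᵢ) * W + bᵢ * (ι S * W)
        ≈⟨ solve 4 (λ x y z w → ((x :* y) :* w :+ y :* (z :* w)) := ((x :+ z) :* (y :* w))) ≈-refl (ι (eᵢ Nat.∸ mᵢ)) bᵢ (ι S) W ⟩
      (ι (eᵢ Nat.∸ mᵢ) + ι S) * (bᵢ * W) ≈⟨ *-congʳ (≈-sym (ι-+ (eᵢ Nat.∸ mᵢ) S)) ⟩
      ι ((eᵢ Nat.∸ mᵢ) Nat.+ S) * (bᵢ * W) ∎
      where
        eᵢ mᵢ : ℕ
        eᵢ = lookup e i
        mᵢ = lookup m i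
        W bᵢ : Carrier
        W  = weightOver L e m
        bᵢ = binom eᵢ mᵢ (a i)
        S : ℕ
        S  = sumᴸ (map (λ t → lookup e t Nat.∸ lookup m t) L)
        -- raising a coordinate t ≠ i leaves the i-th factor alone
        other : ∀ t → i ≢ t → a t * (ι (suc (lookup m t)) * (binom eᵢ (lookup (raise m t) i) (a i) * weightOver L e (raise m t)))
                              ≈ bᵢ * (a t * (ι (suc (lookup m t)) * weightOver L e (raise m t)))
        other t i≢t = ≈-trans (reflexive (cong (λ u → a t * (ι (suc (lookup m t)) * (binom eᵢ u (a i) * weightOver L e (raise m t))))
                                               (Vecₚ.lookup∘update′ i≢t m (suc (lookup m t)))))
                              (solve 4 (λ x y z w → (x :* (y :* (z :* w))) := (z :* (x :* (y :* w)))) ≈-refl (a t) (ι (suc (lookup m t))) bᵢ (weightOver L e (raise m t)))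

    weight-∇ : ∀ e m → ∇ (weight e) m ≈ ι (sum e Nat.∸ sum m) * weight e m
    weight-∇ e m = ≈-trans (weightOver-∇ (allFin n) e m (Uniqueₚ.allFin⁺ n)) gap
      where
        gap : ι (sumᴸ (map (λ t → lookup e t Nat.∸ lookup m t) (allFin n))) * weight e m ≈ ι (sum e Nat.∸ sum m) * weight e m
        gap with below-or-≼ e m
        ... | inj₁ below = ≈-trans (*-congˡ (weight-below e m below)) (≈-trans (zeroʳ _) (≈-sym (≈-trans (*-congˡ (weight-below e m below)) (zeroʳ _))))
        ... | inj₂ m≼e   = *-congʳ (reflexive (cong ι (trans (cong sumᴸ (Listₚ.map-tabulate (λ t → t) (λ t → lookup e t Nat.∸ lookup m t))) (sum-gaps e m m≼e))))

    T : Poly F n → ℕ → Exp n → Carrier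
    T f k m = ⟪ f ∣ (λ e → when (sum e ≟ k Nat.+ sum m) (weight e m)) ⟫

    -- T₀ is f itself: among exponents of degree |m| only m contributes to x^m.
    T-zero : ∀ f m → T f 0 m ≈ coeff F f m
    T-zero f m = ≈-trans (pair-cong f same-degree) (≈-sym (coeff-as-pair f m))
      where
        same-degree : ∀ e → when (sum e ≟ sum m) (weight e m) ≈ when (≡-dec _≟_ e m) 1#
        same-degree e with ≡-dec _≟_ e m
        ... | yes refl = ≈-trans (reflexive (when-yes (sum e ≟ sum e) refl)) (weight-diag e)
        ... | no e≢m with sum e ≟ sum m
        ...   | no _      = ≈-refl
        ...   | yes |e|≡|m| with below-or-≼ e m
        ...     | inj₁ below = weight-below e m below
        ...     | inj₂ m≼e   = ⊥-elim (e≢m (≼-sum-≡ e m m≼e |e|≡|m|))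

    T-∇ : ∀ f k m → ∇ (T f k) m ≈ ι (suc k) * T f (suc k) m
    T-∇ f k m = begin
      ∑ (allFin n) (λ t → a t * (ι (suc (lookup m t)) * ⟪ f ∣ h t ⟫))
        ≈⟨ ∑-cong (allFin n) (λ t → ≈-sym (≈-trans (pair-*ˡ f (a t) _) (*-congˡ (pair-*ˡ f _ (h t))))) ⟩
      ∑ (allFin n) (λ t → ⟪ f ∣ (λ e → a t * (ι (suc (lookup m t)) * h t e)) ⟫)
        ≈⟨ ≈-sym (pair-∑ f (allFin n) (λ t e → a t * (ι (suc (lookup m t)) * h t e))) ⟩
      ⟪ f ∣ (λ e → ∇ (λ m' → when (sum e ≟ k Nat.+ sum m') (weight e m')) m) ⟫
        ≈⟨ pair-cong f one-exponent ⟩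
      ⟪ f ∣ (λ e → ι (suc k) * when (sum e ≟ suc k Nat.+ sum m) (weight e m)) ⟫
        ≈⟨ pair-*ˡ f (ι (suc k)) _ ⟩
      ι (suc k) * T f (suc k) m ∎
      where
        h : Fin n → Exp n → Carrier
        h t e = when (sum e ≟ k Nat.+ sum (raise m t)) (weight e (raise m t))
        -- For a single exponent e this is weight-∇ when |e| = k + 1 + |m|, and 0 = 0 otherwise.
        one-exponent : ∀ e → ∇ (λ m' → when (sum e ≟ k Nat.+ sum m') (weight e m')) m
                           ≈ ι (suc k) * when (sum e ≟ suc k Nat.+ sum m) (weight e m)
        one-exponent e with sum e ≟ suc k Nat.+ sum m
        ... | yes |e|≡ = ≈-trans (∇-cong (λ m' → when (sum e ≟ k Nat.+ sum m') (weight e m')) (weight e) m (λ t → reflexive (when-yes (sum e ≟ _) (degree-after-raise t))))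
                                 (≈-trans (weight-∇ e m) (*-congʳ (reflexive (cong ι gap))))
          where
            degree-after-raise : ∀ t → sum e ≡ k Nat.+ sum (raise m t)
            degree-after-raise t = trans |e|≡ (trans (sym (ℕₚ.+-suc k (sum m))) (cong (k Nat.+_) (sym (sum-raise m t))))
            gap : sum e Nat.∸ sum m ≡ suc k
            gap = trans (cong (Nat._∸ sum m) |e|≡) (ℕₚ.m+n∸n≡m (suc k) (sum m))
        ... | no |e|≢ = ≈-trans (∇-vanish (λ m' → when (sum e ≟ k Nat.+ sum m') (weight e m')) m (λ t → reflexive (when-no (sum e ≟ _) (λ eq → |e|≢ (degree-after-raise t eq)))))
                                (≈-sym (zeroʳ _))
          where
            degree-after-raise : ∀ t → sum e ≡ k Nat.+ sum (raise m t) → sum e ≡ suc k Nat.+ sum m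
            degree-after-raise t eq = trans eq (trans (cong (k Nat.+_) (sum-raise m t)) (ℕₚ.+-suc k (sum m)))

    T-above-degree : ∀ f d → (∀ e → d < sum e → coeff F f e ≈ 0#) → ∀ k m → d < k Nat.+ sum m → T f k m ≈ 0#
    T-above-degree f d deg k m d<k+|m| = pair-vanish f _ vanish
      where
        vanish : ∀ e → (coeff F f e ≈ 0#) ⊎ (when (sum e ≟ k Nat.+ sum m) (weight e m) ≈ 0#)
        vanish e with sum e ≟ k Nat.+ sum m
        ... | yes |e|≡ = inj₁ (deg e (subst (d <_) (sym |e|≡) d<k+|m|))
        ... | no _     = inj₂ ≈-refl

    degreeBound : Poly F n → ℕ
    degreeBound []            = 0
    degreeBound ((γ , e) ∷ f) = sum e Nat.+ degreeBound f

    degreeBound-bounds : ∀ f → All (λ term → sum (proj₂ term) ≤ degreeBound f) f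
    degreeBound-bounds []            = []
    degreeBound-bounds ((γ , e) ∷ f) = ℕₚ.m≤m+n _ _ ∷ All.map (λ le → ℕₚ.≤-trans le (ℕₚ.m≤n+m _ _)) (degreeBound-bounds f)

    coeff-translate-T : ∀ f m → coeff F (translate F a f) m ≈ sumTo (suc (suc (degreeBound f))) (λ k → T f k m)
    coeff-translate-T f m = begin
      coeff F (translate F a f) m ≈⟨ coeff-translate f m ⟩
      ⟪ f ∣ (λ e → weight e m) ⟫   ≈⟨ pair-congᴬ f (All.map (λ {term} |e|≤B → ≈-sym (split-by-degree (proj₂ term) |e|≤B)) (degreeBound-bounds f)) ⟩
      ⟪ f ∣ (λ e → sumTo K (λ k → when (sum e ≟ k Nat.+ sum m) (weight e m))) ⟫ ≈⟨ pair-sumTo f K (λ k e → when (sum e ≟ k Nat.+ sum m) (weight e m)) ⟩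
      sumTo K (λ k → T f k m)     ∎
      where
        K : ℕ
        K = suc (suc (degreeBound f))
        split-by-degree : ∀ e → sum e ≤ degreeBound f → sumTo K (λ k → when (sum e ≟ k Nat.+ sum m) (weight e m)) ≈ weight e m
        split-by-degree e |e|≤B = sumTo-indicator K (sum m) (sum e) (weight e m)
          (ℕₚ.≤-trans (s≤s (ℕₚ.≤-trans |e|≤B (ℕₚ.n≤1+n _))) (ℕₚ.m≤m+n K _))
          below
          where
            below : sum e < sum m → weight e m ≈ 0#
            below |e|<|m| with below-or-≼ e m
            ... | inj₁ eⱼ<mⱼ = weight-below e m eⱼ<mⱼ
            ... | inj₂ m≼e   = ⊥-elim (ℕₚ.<⇒≱ |e|<|m| (sum-mono e m m≼e))

    module _ (f : Poly F n) (d : ℕ) (deg : ∀ e → d < sum e → coeff F f e ≈ 0#)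
             (invertible : ∀ k → k < d → ¬ (ι (suc k) ≈ 0#)) where

      -- Tₖ₊₁(m) is recovered from (k+1) Tₖ₊₁(m): for k < d divide, beyond d it vanishes anyway.
      cancel-T : ∀ k m → ι (suc k) * T f (suc k) m ≈ 0# → T f (suc k) m ≈ 0#
      cancel-T k m vanishes with suc k ≤? d
      ... | yes k<d = cancel-ι (suc k) (invertible k k<d) vanishes
      ... | no k≮d  = T-above-degree f d deg (suc k) m (ℕₚ.≤-trans (ℕₚ.≰⇒> k≮d) (ℕₚ.m≤m+n (suc k) (sum m)))

      ∇f≈T₁ : ∀ m → ∇ (coeff F f) m ≈ T f 1 m
      ∇f≈T₁ m = begin
        ∇ (coeff F f) m  ≈⟨ ∇-cong (coeff F f) (T f 0) m (λ t → ≈-sym (T-zero f (raise m t))) ⟩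
        ∇ (T f 0) m      ≈⟨ T-∇ f 0 m ⟩
        ι 1 * T f 1 m    ≈⟨ ≈-trans (*-congʳ ι-1) (*-identityˡ _) ⟩
        T f 1 m          ∎

      higher-components-vanish : ∀ s → (∀ m → s ≤ sum m → ∇ (coeff F f) m ≈ 0#)
                               → ∀ k m → s ≤ k Nat.+ sum m → T f (suc k) m ≈ 0#
      higher-components-vanish s ∇f≈0 zero    m s≤|m| = ≈-trans (≈-sym (∇f≈T₁ m)) (∇f≈0 m s≤|m|)
      higher-components-vanish s ∇f≈0 (suc k) m s≤k+|m| =
        cancel-T (suc k) m (≈-trans (≈-sym (T-∇ f (suc k) m))
                                    (∇-vanish (T f (suc k)) m (λ t → higher-components-vanish s ∇f≈0 k (raise m t) (raised t))))
        where
          raised : ∀ t → s ≤ k Nat.+ sum (raise m t)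
          raised t = subst (s ≤_) (sym (trans (cong (k Nat.+_) (sum-raise m t)) (ℕₚ.+-suc k (sum m)))) s≤k+|m|

      translation-invariant : (∀ m → ∇ (coeff F f) m ≈ 0#) → ∀ m → coeff F (translate F a f) m ≈ coeff F f m
      translation-invariant ∇f≈0 m = begin
        coeff F (translate F a f) m                                 ≈⟨ coeff-translate-T f m ⟩
        T f 0 m + sumTo (suc (degreeBound f)) (λ k → T f (suc k) m)
          ≈⟨ +-cong (T-zero f m) (sumTo-zero (suc (degreeBound f)) (λ k → higher-components-vanish 0 (λ m' _ → ∇f≈0 m') k m z≤n)) ⟩
        coeff F f m + 0#                                            ≈⟨ +-identityʳ _ ⟩
        coeff F f m                                                 ∎

      -- If f(x + a) = f and f⁽¹⁾ vanishes above degree |m|, then only T₁(m) is left in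
      -- the coefficient of x^m, so it vanishes as well.
      leftover : ∀ m → (∀ m' → suc (sum m) ≤ sum m' → ∇ (coeff F f) m' ≈ 0#)
               → coeff F (translate F a f) m ≈ coeff F f m → ∇ (coeff F f) m ≈ 0#
      leftover m above invariant = +-identityʳ-unique (coeff F f m) (∇ (coeff F f) m) (begin
        coeff F f m + ∇ (coeff F f) m
          ≈⟨ +-cong (≈-sym (T-zero f m)) (≈-trans (∇f≈T₁ m) (≈-sym (+-identityʳ _))) ⟩
        T f 0 m + (T f 1 m + 0#)
          ≈⟨ +-congˡ (+-congˡ (≈-sym (sumTo-zero (degreeBound f)
               (λ k → higher-components-vanish (suc (sum m)) above (suc k) m (s≤s (ℕₚ.m≤n+m (sum m) k)))))) ⟩
        sumTo (suc (suc (degreeBound f))) (λ k → T f k m) ≈⟨ ≈-sym (coeff-translate-T f m) ⟩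
        coeff F (translate F a f) m                       ≈⟨ invariant ⟩
        coeff F f m                                       ∎)

      derivative-vanishes : (∀ m → coeff F (translate F a f) m ≈ coeff F f m) → ∀ m → ∇ (coeff F f) m ≈ 0#
      derivative-vanishes invariant m = descend d m (ℕₚ.m≤m+n d (sum m))
        where
          -- s bounds how far |m| lies below d
          descend : ∀ s m → d ≤ s Nat.+ sum m → ∇ (coeff F f) m ≈ 0#
          descend zero    m d≤|m|   = ∇-vanish (coeff F f) m (λ t → deg (raise m t) (subst (d <_) (sym (sum-raise m t)) (s≤s d≤|m|)))
          descend (suc s) m d≤s+|m| = leftover m (λ m' |m|<|m'| → descend s m' (ℕₚ.≤-trans d≤s+|m|
                                        (subst (Nat._≤ s Nat.+ sum m') (ℕₚ.+-suc s (sum m)) (ℕₚ.+-monoʳ-≤ s |m|<|m'|))))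
                                        (invariant m)

-- The theorem; of IsDegree only the vanishing of coefficients above degree d is used.
lemma4p5 : ∀ {c ℓ : Level} (F : Field c ℓ) (n : ℕ) (f : Poly F n) (d : ℕ)
           → IsDegree F f d
           → (p : ℕ) → HasChar F p → (p ≢ 0 → d < p)
           → (a : Fin n → Field.Carrier F)
           → InS F f a ⇔ _≡ₚ_ F (dirDeriv F a f) (0ₚ F)
lemma4p5 F n f d (deg , _) p char d<p a = mk⇔
    (λ invariant m → Field.trans F (coeff-dirDeriv f m) (derivative-vanishes f d deg invertible invariant m))
    (λ f⁽¹⁾≡0 → translation-invariant f d deg invertible (λ m → Field.trans F (Field.sym F (coeff-dirDeriv f m)) (f⁽¹⁾≡0 m)))
  where
    open OverField F
    open Translation a
    invertible : ∀ k → k < d → ¬ (Field._≈_ F (ι (suc k)) (Field.0# F))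
    invertible = nonzero-below-char p d char d<p
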